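{- Let $q=p^n$, $p$ prime, and let $\mathcal A$ be a proper subset of the points of a projective plane $\Pi_q$ of order $q$ such that for every point $R\in\mathcal A$ there exist integers $0\le m_R,t_R\le p-1$ such that at most one line through $R$ meets $\mathcal A$ in a number of points congruent to $t_R \pmod p$, and all other lines through $R$ meet $\mathcal A$ in a number of points congruent to $m_R\pmod p$. Call $R\in\mathcal A$ regular if it is incident with exactly one line meeting $\mathcal A$ in $t_R \pmod p$ points and with $q$ lines meeting $\mathcal A$ in $m_R\pmod p$ points (so $t_R\neq m_R$); this unique line is called the renitent line at $R$. The other points of $\mathcal A$ are called irregular. Then one of the following holds: (1) Every point of $\mathcal A$ is regular; then $t_P=t_R$ and $m_P=m_R$ for all $P,R\in\mathcal A$, i.e. $\mathcal A$ is a mod $p$ generalized KM-arc of type $(0,m,t)_p$ with $m\neq t$. (2) Every point of $\mathcal A$ is irregular, and hence $\mathcal A$ is a $c$ mod $p$ intersecting point set for some $c$. (3) There is a unique irregular point $Q$, and all renitent lines are incident with $Q$. In this case $\mathcal A\setminus\{Q\}$ is either a mod $p$ generalized KM-arc of type $(0,m,t)_p$ with $m\ne t$ or a $c$ mod $p$ intersecting point set, and in the former case the proper $t_p$-secants of $\mathcal A\setminus\{Q\}$ are concurrent.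
   Context: For a point set $\mathcal S$, an $i_p$-secant ($0\le i\le p-1$) is a line meeting $\mathcal S$ in a number of points congruent to $i\pmod p$; it is proper if it meets $\mathcal S$ in at least one point. A mod $p$ generalized KM-arc of type $(0,m,t)_p$ in a projective plane of order $q=p^n$ is a proper non-empty point set $\mathcal S$ such that every point $R\in\mathcal S$ is incident with a $t_p$-secant and the other $q$ lines through $R$ are $m_p$-secants, where $0\le m,t\le p-1$. For $0\le c\le p-1$, a $c$ mod $p$ intersecting point set is a point set such that every line meeting it in at least one point meets it in a number of points congruent to $c\pmod p$. -}

module Defs where

open import Data.Nat using (ℕ; suc; _+_; _*_; _<_; _≥_)
open import Data.Bool using (Bool; T)
open import Data.Fin using (Fin)
open import Data.Fin.Subset using (Subset; ⊤; _∈_; _∉_; _⊂_; _∩_; ∣_∣; Nonempty; ⁅_⁆; _─_)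
open import Data.Vec using (tabulate)
open import Data.Sum using (_⊎_)
open import Data.Product using (Σ; ∃; ∃-syntax; _×_; _,_)
open import Relation.Binary.PropositionalEquality using (_≡_; _≢_)
open import Relation.Nullary using (¬_)

-- Congruence of natural numbers modulo p: n ≡ m (mod p).
-- (Always used with m < p.)
_≡_[mod_] : ℕ → ℕ → ℕ → Set
n ≡ m [mod p ] = ∃[ k ] (n ≡ m + k * p)

Collinear : {P L : ℕ} → (Fin P → Fin L → Bool) → Fin P → Fin P → Fin P → Set
Collinear inc a b c = ∃[ ℓ ] (T (inc a ℓ) × T (inc b ℓ) × T (inc c ℓ))

record ProjectivePlane (q : ℕ) : Set where
  field
    nPts nLines : ℕ
    inc : Fin nPts → Fin nLines → Bool
    two-points : ∀ (P R : Fin nPts) → P ≢ R →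
      ∃[ ℓ ] (T (inc P ℓ) × T (inc R ℓ) ×
              (∀ ℓ' → T (inc P ℓ') → T (inc R ℓ') → ℓ' ≡ ℓ))
    two-lines : ∀ (ℓ m : Fin nLines) → ℓ ≢ m →
      ∃[ P ] (T (inc P ℓ) × T (inc P m) ×
              (∀ P' → T (inc P' ℓ) → T (inc P' m) → P' ≡ P))
    quadrangle : ∃[ a ] ∃[ b ] ∃[ c ] ∃[ d ]
      (¬ Collinear inc a b c × ¬ Collinear inc a b d ×
       ¬ Collinear inc a c d × ¬ Collinear inc b c d)
    order : ∀ ℓ → ∣ tabulate (λ P → inc P ℓ) ∣ ≡ suc q

module _ {q : ℕ} (Π : ProjectivePlane q) where
  open ProjectivePlane Π

  Point = Fin nPts
  Line  = Fin nLines

  _on_ : Point → Line → Set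
  R on ℓ = T (inc R ℓ)

  pts : Line → Subset nPts
  pts ℓ = tabulate (λ P → inc P ℓ)

  meet : Subset nPts → Line → ℕ
  meet S ℓ = ∣ S ∩ pts ℓ ∣

  LocalCondition : ℕ → Subset nPts → Point → Set
  LocalCondition p A R = ∃[ m ] ∃[ t ] (m < p × t < p ×
    (∀ ℓ → R on ℓ → (meet A ℓ ≡ m [mod p ]) ⊎ (meet A ℓ ≡ t [mod p ])) ×
    (∀ ℓ₁ ℓ₂ → R on ℓ₁ → R on ℓ₂ →
       ¬ (meet A ℓ₁ ≡ m [mod p ]) → ¬ (meet A ℓ₂ ≡ m [mod p ]) → ℓ₁ ≡ ℓ₂))

  RenitentWith : ℕ → Subset nPts → ℕ → ℕ → Point → Line → Set
  RenitentWith p A m t R ℓ = R on ℓ × meet A ℓ ≡ t [mod p ] ×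
    (∀ ℓ' → R on ℓ' → ℓ' ≢ ℓ → meet A ℓ' ≡ m [mod p ])

  Renitent : ℕ → Subset nPts → Point → Line → Set
  Renitent p A R ℓ = ∃[ m ] ∃[ t ] (m < p × t < p × m ≢ t × RenitentWith p A m t R ℓ)

  Regular : ℕ → Subset nPts → Point → Set
  Regular p A R = ∃[ ℓ ] Renitent p A R ℓ

  GenKMArc : ℕ → ℕ → ℕ → Subset nPts → Set
  GenKMArc p m t S = m < p × t < p × S ⊂ ⊤ × Nonempty S ×
    (∀ R → R ∈ S → ∃[ ℓ ] RenitentWith p S m t R ℓ)

  Intersecting : ℕ → ℕ → Subset nPts → Set
  Intersecting p c S = c < p × (∀ ℓ → meet S ℓ ≥ 1 → meet S ℓ ≡ c [mod p ])

module Submission where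

-- The key fact (forced-residue) is a count: the q + 1 lines through R ∈ A
-- cover A, counting R q + 1 times and every other point once, so their
-- intersection numbers sum to |A| + q ≡ |A| (mod p).  Hence if all lines
-- through R but one are ≡ m, the remaining line is ≡ |A|.  So a point of A is
-- either flat (all its lines ≡ |A|; these are exactly the irregular points) or
-- has a renitency: one line ≡ |A| and a residue m ≢ |A| on all other lines.
-- Incidence arguments then show that renitent lines pass through every flat
-- point, that all renitent points share their residue m, and that two flat
-- points exclude renitent ones.  The three alternatives are: no flat point,
-- only flat points, or a single flat point Q, where the same results applied
-- to A ─ ⁅ Q ⁆ describe the remainder.

open import Defs
open import Data.Nat using (ℕ; _^_; _≥_)
open import Data.Nat.Primality using (Prime)
open import Data.Fin.Subset using (Subset; ⊤; _∈_; _⊂_; ⁅_⁆; _─_)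
open import Data.Product using (∃; ∃-syntax; _×_)
open import Data.Sum using (_⊎_)
open import Relation.Binary.PropositionalEquality using (_≡_; _≢_)
open import Relation.Nullary using (¬_)

open import Data.Bool using (Bool; true; false; T; _∧_; not)
open import Data.Bool.Properties using (T?; T-≡; ∧-zeroʳ; ∧-identityʳ)
open import Data.Empty renaming (⊥ to Empty) using (⊥-elim)
open import Data.Fin using (Fin; zero; suc; punchIn)
open import Data.Fin.Properties using (_≟_; any?; all?; punchInᵢ≢i)
open import Data.Fin.Subset using (∣_∣; _∩_; _-_; Nonempty)
open import Data.Fin.Subset.Properties
  using (_∈?_; ∈⊤; p─⊥≡p; p─q⊆p; nonempty?; Empty-unique; ∣⊥∣≡0; x∈p∩q⁻; x∈p⇒∣p-x∣<∣p∣; x∈p∧x≢y⇒x∈p-y)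
open import Data.Nat using (zero; suc; _+_; _*_; _≤_; _<_; _%_; _/_; NonZero; z≤n; s≤s; s≤s⁻¹; >-nonZero⁻¹)
open import Data.Nat.DivMod using (%-distribˡ-+; [m+kn]%n≡m%n; m≡m%n+[m/n]*n; m<n⇒m%n≡m; m%n<n; %-remove-+ʳ)
open import Data.Nat.Divisibility using (_∣_; ∣m⇒∣m*n; m∣m*n)
open import Data.Nat.Primality using (prime⇒nonZero)
open import Data.Nat.Properties
  using (+-*-semiring; *-commutativeSemigroup; +-comm; +-identityʳ; *-identityʳ; *-zeroʳ; suc-injective; ≤-trans)
  renaming (_≟_ to _≟ℕ_)
open import Algebra.Properties.CommutativeSemigroup *-commutativeSemigroup using (x∙yz≈y∙xz)
open import Algebra.Properties.Semiring.Sum +-*-semiring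
  using (sum; sum-cong-≗; sum-replicate-zero; sum-remove; ∑-distrib-+; ∑-comm; *-distribˡ-sum; *-distribʳ-sum)
open import Data.Product using (_,_; proj₁; proj₂)
open import Data.Sum using (inj₁; inj₂)
open import Data.Vec using ([]; _∷_; lookup)
open import Data.Vec.Functional using (removeAt)
open import Data.Vec.Properties using ([]=⇒lookup; lookup⇒[]=; lookup-zipWith; lookup∘tabulate)
open import Function using (_∘_)
open import Function.Bundles using (Equivalence)
open import Relation.Binary.PropositionalEquality using (refl; sym; trans; cong; cong₂; subst; module ≡-Reasoning)
open import Relation.Nullary using (Dec; yes; no; does)
open import Relation.Nullary.Decidable using (dec-true; dec-false; decidable-stable; _×-dec_; _→-dec_; ¬?)

𝟙 : Bool → ℕ
𝟙 true  = 1
𝟙 false = 0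

𝟙-∧ : ∀ a b → 𝟙 (a ∧ b) ≡ 𝟙 a * 𝟙 b
𝟙-∧ true  b = sym (+-identityʳ (𝟙 b))
𝟙-∧ false b = refl

𝟙-T : ∀ {b} → T b → 𝟙 b ≡ 1
𝟙-T {true} _ = refl

𝟙-¬T : ∀ {b} → ¬ T b → 𝟙 b ≡ 0
𝟙-¬T {true}  ¬t = ⊥-elim (¬t _)
𝟙-¬T {false} _  = refl

𝟙-disjoint : ∀ a b → (T a → T b → Empty) → 𝟙 a * 𝟙 b ≡ 0
𝟙-disjoint true  true  h = ⊥-elim (h _ _)
𝟙-disjoint true  false h = refl
𝟙-disjoint false b     h = refl

𝟙-weight : ∀ b x → (T b → x ≡ 1) → 𝟙 b * x ≡ 𝟙 b
𝟙-weight true  x h = trans (+-identityʳ x) (h _)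
𝟙-weight false x h = refl

sum-zero : ∀ {n} (f : Fin n → ℕ) → (∀ i → f i ≡ 0) → sum f ≡ 0
sum-zero {n} f h = trans (sum-cong-≗ h) (sum-replicate-zero n)

sum-single : ∀ {n} (f : Fin n → ℕ) (j : Fin n) → (∀ i → i ≢ j → f i ≡ 0) → sum f ≡ f j
sum-single {suc n} f j h = begin
  sum f                        ≡⟨ sum-remove f ⟩
  f j + sum (removeAt f j)     ≡⟨ cong (f j +_) (sum-zero (removeAt f j) (λ i → h _ (punchInᵢ≢i j i))) ⟩
  f j + 0                      ≡⟨ +-identityʳ (f j) ⟩
  f j                          ∎
  where open ≡-Reasoning

sum-except : ∀ {n} → Fin n → (Fin n → ℕ) → ℕ
sum-except {suc n} j f = sum (removeAt f j)

sum-split : ∀ {n} (f : Fin n → ℕ) j → sum f ≡ f j + sum-except j f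
sum-split {suc n} f j = sum-remove f

sum-except-*ʳ : ∀ {n} (j : Fin n) f m → sum-except j f * m ≡ sum-except j (λ i → f i * m)
sum-except-*ʳ {suc n} j f m = *-distribʳ-sum m (removeAt f j)

sum-at : ∀ {n} (j : Fin n) x → sum (λ i → 𝟙 (does (i ≟ j)) * x) ≡ x
sum-at j x = trans (sum-single _ j off-j) at-j
  where
  off-j : ∀ i → i ≢ j → 𝟙 (does (i ≟ j)) * x ≡ 0
  off-j i i≢j rewrite dec-false (i ≟ j) i≢j = refl
  at-j : 𝟙 (does (j ≟ j)) * x ≡ x
  at-j rewrite dec-true (j ≟ j) refl = +-identityʳ x

card-sum : ∀ {n} (S : Subset n) → ∣ S ∣ ≡ sum (λ i → 𝟙 (lookup S i))
card-sum []          = refl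
card-sum (true ∷ S)  = cong suc (card-sum S)
card-sum (false ∷ S) = card-sum S

∈⇒T : ∀ {n} {S : Subset n} {i} → i ∈ S → T (lookup S i)
∈⇒T i∈S rewrite []=⇒lookup i∈S = _

T⇒∈ : ∀ {n} (S : Subset n) i → T (lookup S i) → i ∈ S
T⇒∈ S i t = lookup⇒[]= i S (Equivalence.to T-≡ t)

lookup-─⁅⁆ : ∀ {n} (S : Subset n) (j i : Fin n) → lookup (S ─ ⁅ j ⁆) i ≡ lookup S i ∧ not (does (i ≟ j))
lookup-─⁅⁆ (s ∷ S) zero    zero    = sym (∧-zeroʳ s)
lookup-─⁅⁆ (s ∷ S) zero    (suc i) = trans (cong (λ S′ → lookup S′ i) (p─⊥≡p S)) (sym (∧-identityʳ _))
lookup-─⁅⁆ (s ∷ S) (suc j) zero    = sym (∧-identityʳ s)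
lookup-─⁅⁆ (s ∷ S) (suc j) (suc i) = lookup-─⁅⁆ S j i

∈─⁅⁆⇒≢ : ∀ {n} {S : Subset n} {i j} → i ∈ S ─ ⁅ j ⁆ → i ≢ j
∈─⁅⁆⇒≢ {S = S} {i} {j} i∈S─j refl with ∈⇒T i∈S─j
... | t rewrite lookup-─⁅⁆ S i i | dec-true (i ≟ i) refl | ∧-zeroʳ (lookup S i) = t

three-elements : ∀ {n} {S : Subset n} {a b c} → a ∈ S → b ∈ S → c ∈ S →
                 a ≢ b → a ≢ c → b ≢ c → 3 ≤ ∣ S ∣
three-elements {S = S} {a} {b} {c} a∈S b∈S c∈S a≢b a≢c b≢c =
  ≤-trans (s≤s (≤-trans (s≤s (≤-trans (s≤s z≤n) drop-c)) drop-b)) drop-a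
  where
  drop-a : ∣ S - a ∣ < ∣ S ∣
  drop-a = x∈p⇒∣p-x∣<∣p∣ a∈S
  drop-b : ∣ S - a - b ∣ < ∣ S - a ∣
  drop-b = x∈p⇒∣p-x∣<∣p∣ (x∈p∧x≢y⇒x∈p-y b∈S (a≢b ∘ sym))
  drop-c : ∣ S - a - b - c ∣ < ∣ S - a - b ∣
  drop-c = x∈p⇒∣p-x∣<∣p∣ (x∈p∧x≢y⇒x∈p-y (x∈p∧x≢y⇒x∈p-y c∈S (a≢c ∘ sym)) (b≢c ∘ sym))

module Residues (p : ℕ) .{{_ : NonZero p}} where

  mod⇒% : ∀ {a m} → a ≡ m [mod p ] → a % p ≡ m % p
  mod⇒% {m = m} (k , refl) = [m+kn]%n≡m%n m k p

  mod⇒residue : ∀ {a m} → m < p → a ≡ m [mod p ] → a % p ≡ m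
  mod⇒residue m<p a≡m = trans (mod⇒% a≡m) (m<n⇒m%n≡m m<p)

  residue⇒mod : ∀ {a m} → a % p ≡ m → a ≡ m [mod p ]
  residue⇒mod {a} a%p≡m = a / p , trans (m≡m%n+[m/n]*n a p) (cong (_+ a / p * p) a%p≡m)

  +-congˡ-% : ∀ a {b c} → b % p ≡ c % p → (a + b) % p ≡ (a + c) % p
  +-congˡ-% a {b} {c} b≡c = begin
    (a + b) % p             ≡⟨ %-distribˡ-+ a b p ⟩
    (a % p + b % p) % p     ≡⟨ cong (λ x → (a % p + x) % p) b≡c ⟩
    (a % p + c % p) % p     ≡⟨ %-distribˡ-+ a c p ⟨
    (a + c) % p             ∎
    where open ≡-Reasoning

  sum-cong-% : ∀ {n} (f g : Fin n → ℕ) → (∀ i → f i % p ≡ g i % p) → sum f % p ≡ sum g % p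
  sum-cong-% {zero}  f g h = refl
  sum-cong-% {suc n} f g h = begin
    (f zero + sum (f ∘ suc)) % p   ≡⟨ +-congˡ-% (f zero) (sum-cong-% (f ∘ suc) (g ∘ suc) (h ∘ suc)) ⟩
    (f zero + sum (g ∘ suc)) % p   ≡⟨ cong (_% p) (+-comm (f zero) _) ⟩
    (sum (g ∘ suc) + f zero) % p   ≡⟨ +-congˡ-% (sum (g ∘ suc)) (h zero) ⟩
    (sum (g ∘ suc) + g zero) % p   ≡⟨ cong (_% p) (+-comm _ (g zero)) ⟩
    (g zero + sum (g ∘ suc)) % p   ∎
    where open ≡-Reasoning

  sum-except-cong-% : ∀ {n} (j : Fin n) f g → (∀ i → i ≢ j → f i % p ≡ g i % p) →
                      sum-except j f % p ≡ sum-except j g % p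
  sum-except-cong-% {suc n} j f g h = sum-cong-% _ _ (λ i → h (punchIn j i) (punchInᵢ≢i j i))

  𝟙-weight-% : ∀ b x y → (T b → x % p ≡ y % p) → (𝟙 b * x) % p ≡ (𝟙 b * y) % p
  𝟙-weight-% true  x y h rewrite +-identityʳ x | +-identityʳ y = h _
  𝟙-weight-% false x y h = refl

module Geometry {q : ℕ} (Π : ProjectivePlane q) where
  open ProjectivePlane Π

  infix 4 _I_
  _I_ : Fin nPts → Fin nLines → Set
  R I ℓ = _on_ Π R ℓ

  on⇒∈pts : ∀ {P ℓ} → P I ℓ → P ∈ pts Π ℓ
  on⇒∈pts {P} {ℓ} Pℓ = lookup⇒[]= P (pts Π ℓ) (trans (lookup∘tabulate _ P) (Equivalence.to T-≡ Pℓ))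

  ∈pts⇒on : ∀ {P ℓ} → P ∈ pts Π ℓ → P I ℓ
  ∈pts⇒on {P} P∈ℓ = subst T (lookup∘tabulate _ P) (∈⇒T P∈ℓ)

  meet-sum : ∀ S ℓ → meet Π S ℓ ≡ sum (λ P → 𝟙 (lookup S P) * 𝟙 (inc P ℓ))
  meet-sum S ℓ = trans (card-sum (S ∩ pts Π ℓ)) (sum-cong-≗ {nPts} entry)
    where
    entry : ∀ P → 𝟙 (lookup (S ∩ pts Π ℓ) P) ≡ 𝟙 (lookup S P) * 𝟙 (inc P ℓ)
    entry P = trans (cong 𝟙 (trans (lookup-zipWith _∧_ P S (pts Π ℓ))
                                   (cong (lookup S P ∧_) (lookup∘tabulate _ P))))
                    (𝟙-∧ (lookup S P) (inc P ℓ))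

  degree : Fin nPts → ℕ
  degree R = sum (λ ℓ → 𝟙 (inc R ℓ))

  joins : Fin nPts → Fin nPts → ℕ
  joins R P = sum (λ ℓ → 𝟙 (inc R ℓ) * 𝟙 (inc P ℓ))

  points-on-line : ∀ ℓ → sum (λ P → 𝟙 (inc P ℓ)) ≡ suc q
  points-on-line ℓ = begin
    sum (λ P → 𝟙 (inc P ℓ))         ≡⟨ sum-cong-≗ {nPts} (λ P → cong 𝟙 (lookup∘tabulate _ P)) ⟨
    sum (λ P → 𝟙 (lookup (pts Π ℓ) P)) ≡⟨ card-sum (pts Π ℓ) ⟨
    ∣ pts Π ℓ ∣                       ≡⟨ order ℓ ⟩
    suc q                            ∎
    where open ≡-Reasoning

  meet-once : ∀ {ℓ m P P′} → ℓ ≢ m → P I ℓ → P I m → P′ I ℓ → P′ I m → P ≡ P′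
  meet-once {ℓ} {m} ℓ≢m Pℓ Pm P′ℓ P′m =
    let (_ , _ , _ , unique) = two-lines ℓ m ℓ≢m in trans (unique _ Pℓ Pm) (sym (unique _ P′ℓ P′m))

  join-once : ∀ {P R ℓ m} → P ≢ R → P I ℓ → R I ℓ → P I m → R I m → ℓ ≡ m
  join-once {P} {R} P≢R Pℓ Rℓ Pm Rm =
    let (_ , _ , _ , unique) = two-points P R P≢R in trans (unique _ Pℓ Rℓ) (sym (unique _ Pm Rm))

  joins-distinct : ∀ R P → R ≢ P → joins R P ≡ 1
  joins-distinct R P R≢P =
    let (L , RL , PL , unique) = two-points R P R≢P
    in trans (sum-single _ L (λ ℓ ℓ≢L → 𝟙-disjoint _ _ (λ Rℓ Pℓ → ℓ≢L (unique ℓ Rℓ Pℓ))))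
             (cong₂ _*_ (𝟙-T RL) (𝟙-T PL))

  joins-self : ∀ R → joins R R ≡ degree R
  joins-self R = sum-cong-≗ {nLines} (λ ℓ → 𝟙-weight (inc R ℓ) _ 𝟙-T)

  common-points : ∀ ℓ m → ℓ ≢ m → sum (λ P → 𝟙 (inc P ℓ) * 𝟙 (inc P m)) ≡ 1
  common-points ℓ m ℓ≢m =
    let (X , Xℓ , Xm , unique) = two-lines ℓ m ℓ≢m
    in trans (sum-single _ X (λ P P≢X → 𝟙-disjoint _ _ (λ Pℓ Pm → P≢X (unique P Pℓ Pm))))
             (cong₂ _*_ (𝟙-T Xℓ) (𝟙-T Xm))

  double-count : ∀ (w : Fin nPts → ℕ) R →
    sum (λ ℓ → 𝟙 (inc R ℓ) * sum (λ P → w P * 𝟙 (inc P ℓ))) ≡ sum (λ P → w P * joins R P)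
  double-count w R = begin
    sum (λ ℓ → 𝟙 (inc R ℓ) * sum (λ P → w P * 𝟙 (inc P ℓ)))
      ≡⟨ sum-cong-≗ {nLines} (λ ℓ → *-distribˡ-sum {nPts} (𝟙 (inc R ℓ)) _) ⟩
    sum (λ ℓ → sum (λ P → 𝟙 (inc R ℓ) * (w P * 𝟙 (inc P ℓ))))
      ≡⟨ ∑-comm {nLines} {nPts} _ ⟩
    sum (λ P → sum (λ ℓ → 𝟙 (inc R ℓ) * (w P * 𝟙 (inc P ℓ))))
      ≡⟨ sum-cong-≗ {nPts} (λ P → sum-cong-≗ {nLines} (λ ℓ → x∙yz≈y∙xz (𝟙 (inc R ℓ)) (w P) _)) ⟩
    sum (λ P → sum (λ ℓ → w P * (𝟙 (inc R ℓ) * 𝟙 (inc P ℓ))))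
      ≡⟨ sum-cong-≗ {nPts} (λ P → *-distribˡ-sum {nLines} (w P) _) ⟨
    sum (λ P → w P * joins R P) ∎
    where open ≡-Reasoning

  point-on : ∀ S ℓ → meet Π S ℓ ≥ 1 → ∃[ P ] (P ∈ S × P I ℓ)
  point-on S ℓ meet≥1 with nonempty? (S ∩ pts Π ℓ)
  ... | yes (P , P∈S∩ℓ) = let (P∈S , P∈ℓ) = x∈p∩q⁻ S (pts Π ℓ) P∈S∩ℓ in P , P∈S , ∈pts⇒on P∈ℓ
  ... | no  empty       = ⊥-elim (1≰0 (subst (1 ≤_) meet≡0 meet≥1))
    where
    meet≡0 : meet Π S ℓ ≡ 0
    meet≡0 = trans (cong ∣_∣ (Empty-unique empty)) (∣⊥∣≡0 nPts)
    1≰0 : ¬ (1 ≤ 0)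
    1≰0 ()

  meet-─⁅⁆ : ∀ S {Q ℓ} → ¬ Q I ℓ → meet Π (S ─ ⁅ Q ⁆) ℓ ≡ meet Π S ℓ
  meet-─⁅⁆ S {Q} {ℓ} ¬Qℓ = trans (meet-sum (S ─ ⁅ Q ⁆) ℓ) (trans (sum-cong-≗ {nPts} term) (sym (meet-sum S ℓ)))
    where
    term : ∀ P → 𝟙 (lookup (S ─ ⁅ Q ⁆) P) * 𝟙 (inc P ℓ) ≡ 𝟙 (lookup S P) * 𝟙 (inc P ℓ)
    term P rewrite lookup-─⁅⁆ S Q P with P ≟ Q
    ... | yes refl rewrite 𝟙-¬T ¬Qℓ = trans (*-zeroʳ (𝟙 (lookup S Q ∧ false))) (sym (*-zeroʳ (𝟙 (lookup S Q))))
    ... | no  _    rewrite ∧-identityʳ (lookup S P) = refl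

  -- The remaining facts need two distinct points X₀ ≢ Y₀; this excludes the
  -- degenerate one-point incidence structure without lines, which meets the axioms vacuously.
  module NonDegenerate {X₀ Y₀ : Fin nPts} (X₀≢Y₀ : X₀ ≢ Y₀) where

    join : ∀ Y Z → ∃[ ℓ ] (Y I ℓ × Z I ℓ)
    join Y Z with Y ≟ Z
    ... | no Y≢Z = let (ℓ , Yℓ , Zℓ , _) = two-points Y Z Y≢Z in ℓ , Yℓ , Zℓ
    join Y .Y | yes refl with Y ≟ X₀
    ... | no Y≢X₀ = let (ℓ , Yℓ , _) = two-points Y X₀ Y≢X₀ in ℓ , Yℓ , Yℓ
    ... | yes refl = let (ℓ , Yℓ , _) = two-points Y Y₀ X₀≢Y₀ in ℓ , Yℓ , Yℓ

    noncollinear-distinct : ∀ {a b c} → ¬ Collinear inc a b c → a ≢ b × a ≢ c × b ≢ c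
    noncollinear-distinct {a} {b} {c} ¬abc =
        (λ { refl → let (ℓ , aℓ , cℓ) = join a c in ¬abc (ℓ , aℓ , aℓ , cℓ) })
      , (λ { refl → let (ℓ , aℓ , bℓ) = join a b in ¬abc (ℓ , aℓ , bℓ , aℓ) })
      , (λ { refl → let (ℓ , aℓ , bℓ) = join a b in ¬abc (ℓ , aℓ , bℓ , bℓ) })

    -- every line misses a point: not all of a triangle lies on it
    point-off : ∀ ℓ → ∃[ Y ] ¬ Y I ℓ
    point-off ℓ with quadrangle
    ... | a , b , c , _ , ¬abc , _ with T? (inc a ℓ) | T? (inc b ℓ) | T? (inc c ℓ)
    ... | no ¬aℓ | _      | _      = a , ¬aℓ
    ... | yes _  | no ¬bℓ | _      = b , ¬bℓ
    ... | yes _  | yes _  | no ¬cℓ = c , ¬cℓ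
    ... | yes aℓ | yes bℓ | yes cℓ = ⊥-elim (¬abc (ℓ , aℓ , bℓ , cℓ))

    -- every point misses a line: it cannot lie on all three sides of a triangle
    line-off : ∀ R → ∃[ ℓ ] ¬ R I ℓ
    line-off R with quadrangle
    ... | a , b , c , _ , ¬abc , _ with noncollinear-distinct ¬abc
    ... | a≢b , a≢c , b≢c with two-points a b a≢b | two-points a c a≢c | two-points b c b≢c
    ... | ab , a₁ , b₁ , _ | ac , a₂ , c₂ , _ | bc , b₃ , c₃ , _
      with T? (inc R ab) | T? (inc R ac) | T? (inc R bc)
    ... | no ¬R₁ | _      | _      = ab , ¬R₁
    ... | yes _  | no ¬R₂ | _      = ac , ¬R₂
    ... | yes _  | yes _  | no ¬R₃ = bc , ¬R₃
    ... | yes R₁ | yes R₂ | yes R₃ = ⊥-elim (a≢b (trans (sym R≡a) R≡b))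
      where
      R≡a : R ≡ a
      R≡a = meet-once (λ { refl → ¬abc (ab , a₁ , b₁ , c₂) }) R₁ R₂ a₁ a₂
      R≡b : R ≡ b
      R≡b = meet-once (λ { refl → ¬abc (ab , a₁ , b₁ , c₃) }) R₁ R₃ b₁ b₃

    another-line : ∀ {R ℓ} → R I ℓ → ∃[ ℓ′ ] (ℓ′ ≢ ℓ × R I ℓ′)
    another-line {R} {ℓ} Rℓ with point-off ℓ
    ... | Y , ¬Yℓ with two-points R Y (λ { refl → ¬Yℓ Rℓ })
    ... | ℓ′ , Rℓ′ , Yℓ′ , _ = ℓ′ , (λ ℓ′≡ℓ → ¬Yℓ (subst (Y I_) ℓ′≡ℓ Yℓ′)) , Rℓ′

    -- every point lies on q + 1 lines (count the flags through R against a line missing R)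
    degree≡q+1 : ∀ R → degree R ≡ suc q
    degree≡q+1 R = begin
      degree R
        ≡⟨ sum-cong-≗ {nLines} (λ ℓ → 𝟙-weight (inc R ℓ) _ (λ Rℓ → common-points ℓ₀ ℓ (λ { refl → ¬Rℓ₀ Rℓ }))) ⟨
      sum (λ ℓ → 𝟙 (inc R ℓ) * sum (λ P → 𝟙 (inc P ℓ₀) * 𝟙 (inc P ℓ)))
        ≡⟨ double-count (λ P → 𝟙 (inc P ℓ₀)) R ⟩
      sum (λ P → 𝟙 (inc P ℓ₀) * joins R P)
        ≡⟨ sum-cong-≗ {nPts} (λ P → 𝟙-weight (inc P ℓ₀) _ (λ Pℓ₀ → joins-distinct R P (λ { refl → ¬Rℓ₀ Pℓ₀ }))) ⟩
      sum (λ P → 𝟙 (inc P ℓ₀))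
        ≡⟨ points-on-line ℓ₀ ⟩
      suc q ∎
      where
      open ≡-Reasoning
      ℓ₀ : Fin nLines
      ℓ₀ = proj₁ (line-off R)
      ¬Rℓ₀ : ¬ R I ℓ₀
      ¬Rℓ₀ = proj₂ (line-off R)

    -- the order is at least 2: the line ab also carries its intersection with cd
    order≥2 : 2 ≤ q
    order≥2 with quadrangle
    ... | a , b , c , d , ¬abc , _ , ¬acd , ¬bcd with noncollinear-distinct ¬abc | noncollinear-distinct ¬acd
    ... | a≢b , _ | _ , _ , c≢d with two-points a b a≢b | two-points c d c≢d
    ... | ab , a₁ , b₁ , _ | cd , c₂ , d₂ , _ with two-lines ab cd (λ { refl → ¬abc (ab , a₁ , b₁ , c₂) })
    ... | X , X₁ , X₂ , _ =
      s≤s⁻¹ (subst (3 ≤_) (order ab)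
        (three-elements (on⇒∈pts a₁) (on⇒∈pts b₁) (on⇒∈pts X₁) a≢b
          (λ { refl → ¬acd (cd , X₂ , c₂ , d₂) }) (λ { refl → ¬bcd (cd , X₂ , c₂ , d₂) })))

    -- Counting the points of S on the lines through R ∈ S: R is counted
    -- q + 1 times, every other point of S exactly once.
    incidence-sum : ∀ S R → R ∈ S → sum (λ ℓ → 𝟙 (inc R ℓ) * meet Π S ℓ) ≡ ∣ S ∣ + q
    incidence-sum S R R∈S = begin
      sum (λ ℓ → 𝟙 (inc R ℓ) * meet Π S ℓ)
        ≡⟨ sum-cong-≗ {nLines} (λ ℓ → cong (𝟙 (inc R ℓ) *_) (meet-sum S ℓ)) ⟩
      sum (λ ℓ → 𝟙 (inc R ℓ) * sum (λ P → 𝟙 (lookup S P) * 𝟙 (inc P ℓ)))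
        ≡⟨ double-count (λ P → 𝟙 (lookup S P)) R ⟩
      sum (λ P → 𝟙 (lookup S P) * joins R P)
        ≡⟨ sum-cong-≗ {nPts} term ⟩
      sum (λ P → 𝟙 (lookup S P) + 𝟙 (does (P ≟ R)) * q)
        ≡⟨ ∑-distrib-+ {nPts} _ _ ⟩
      sum (λ P → 𝟙 (lookup S P)) + sum (λ P → 𝟙 (does (P ≟ R)) * q)
        ≡⟨ cong₂ _+_ (sym (card-sum S)) (sum-at R q) ⟩
      ∣ S ∣ + q ∎
      where
      open ≡-Reasoning
      term : ∀ P → 𝟙 (lookup S P) * joins R P ≡ 𝟙 (lookup S P) + 𝟙 (does (P ≟ R)) * q
      term P with P ≟ R
      ... | yes refl rewrite 𝟙-T (∈⇒T R∈S) | joins-self R | degree≡q+1 R = refl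
      ... | no  P≢R  = trans (cong (𝟙 (lookup S P) *_) (joins-distinct R P (P≢R ∘ sym)))
                             (trans (*-identityʳ _) (sym (+-identityʳ _)))

module Alternatives {q : ℕ} (Π : ProjectivePlane q) (p : ℕ) where
  open ProjectivePlane Π
  open Geometry Π

  AllRegular : Subset nPts → Set
  AllRegular A = (∀ R → R ∈ A → Regular Π p A R) × (∃[ m ] ∃[ t ] (m ≢ t × GenKMArc Π p m t A))

  AllIrregular : Subset nPts → Set
  AllIrregular A = (∀ R → R ∈ A → ¬ Regular Π p A R) × (∃[ c ] Intersecting Π p c A)

  KMArcOrIntersecting : Subset nPts → Set
  KMArcOrIntersecting S =
    (∃[ m ] ∃[ t ] (m ≢ t × GenKMArc Π p m t S ×
      (∃[ X ] (∀ ℓ → meet Π S ℓ ≥ 1 → meet Π S ℓ ≡ t [mod p ] → X I ℓ))))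
    ⊎ (∃[ c ] Intersecting Π p c S)

  OneIrregular : Subset nPts → Set
  OneIrregular A = ∃[ Q ] (Q ∈ A × ¬ Regular Π p A Q ×
    (∀ R → R ∈ A → R ≢ Q → Regular Π p A R) ×
    (∀ R ℓ → R ∈ A → Renitent Π p A R ℓ → Q I ℓ) ×
    KMArcOrIntersecting (A ─ ⁅ Q ⁆))

  empty-irregular : 0 < p → ∀ A → ¬ Nonempty A → AllIrregular A
  empty-irregular 0<p A empty = (λ R R∈A _ → empty (R , R∈A)) , 0 , 0<p ,
    λ ℓ meets → let (P , P∈A , _) = point-on A ℓ meets in ⊥-elim (empty (P , P∈A))

module Setting {q : ℕ} (Π : ProjectivePlane q) {X₀ Y₀ : Fin (ProjectivePlane.nPts Π)} (X₀≢Y₀ : X₀ ≢ Y₀)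
               (p : ℕ) .{{_ : NonZero p}} (p∣q : p ∣ q) where
  open ProjectivePlane Π
  open Geometry Π
  open NonDegenerate X₀≢Y₀
  open Residues p
  open Alternatives Π p

  module Classification (A : Subset nPts) where

    M : Fin nLines → ℕ
    M ℓ = meet Π A ℓ

    -- the residue of |A|, which (by forced-residue) every exceptional line carries
    s : ℕ
    s = ∣ A ∣ % p

    s<p : s < p
    s<p = m%n<n ∣ A ∣ p

    -- If all lines through R ∈ A except possibly ℓ₁ meet A in ≡ m points, then
    -- ℓ₁ meets A in ≡ |A| points: the lines through R cover A, counting R
    -- q + 1 times, and p divides q.
    forced-residue : ∀ {R ℓ₁} m → R ∈ A → R I ℓ₁ →
      (∀ ℓ → R I ℓ → ℓ ≢ ℓ₁ → M ℓ % p ≡ m % p) → M ℓ₁ % p ≡ s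
    forced-residue {R} {ℓ₁} m R∈A Rℓ₁ others = begin
      M ℓ₁ % p
        ≡⟨ %-remove-+ʳ (M ℓ₁) (∣m⇒∣m*n m p∣q) ⟨
      (M ℓ₁ + q * m) % p
        ≡⟨ cong (λ k → (M ℓ₁ + k) % p) (trans (sym (sum-except-*ʳ ℓ₁ through-R m)) (cong (_* m) other-lines)) ⟨
      (M ℓ₁ + sum-except ℓ₁ (λ ℓ → 𝟙 (inc R ℓ) * m)) % p
        ≡⟨ +-congˡ-% (M ℓ₁) (sum-except-cong-% ℓ₁ _ _ (λ ℓ ℓ≢ℓ₁ → 𝟙-weight-% _ _ _ (λ Rℓ → others ℓ Rℓ ℓ≢ℓ₁))) ⟨
      (M ℓ₁ + sum-except ℓ₁ weighted) % p
        ≡⟨ cong (λ x → (x + sum-except ℓ₁ weighted) % p) weighted-ℓ₁ ⟨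
      (weighted ℓ₁ + sum-except ℓ₁ weighted) % p
        ≡⟨ cong (_% p) (sum-split weighted ℓ₁) ⟨
      sum weighted % p
        ≡⟨ cong (_% p) (incidence-sum A R R∈A) ⟩
      (∣ A ∣ + q) % p
        ≡⟨ %-remove-+ʳ ∣ A ∣ p∣q ⟩
      s ∎
      where
      open ≡-Reasoning
      through-R weighted : Fin nLines → ℕ
      through-R ℓ = 𝟙 (inc R ℓ)
      weighted  ℓ = 𝟙 (inc R ℓ) * M ℓ
      weighted-ℓ₁ : weighted ℓ₁ ≡ M ℓ₁
      weighted-ℓ₁ rewrite 𝟙-T Rℓ₁ = +-identityʳ (M ℓ₁)
      other-lines : sum-except ℓ₁ through-R ≡ q
      other-lines = suc-injective (begin
        suc (sum-except ℓ₁ through-R)            ≡⟨ cong (_+ sum-except ℓ₁ through-R) (𝟙-T Rℓ₁) ⟨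
        through-R ℓ₁ + sum-except ℓ₁ through-R   ≡⟨ sum-split through-R ℓ₁ ⟨
        degree R                                 ≡⟨ degree≡q+1 R ⟩
        suc q                                    ∎)

    Flat : Fin nPts → Set
    Flat R = ∀ ℓ → R I ℓ → M ℓ % p ≡ s

    flat? : ∀ R → Dec (Flat R)
    flat? R = all? (λ ℓ → T? (inc R ℓ) →-dec (M ℓ % p ≟ℕ s))

    record Renitency (R : Fin nPts) : Set where
      field
        line         : Fin nLines
        residue      : ℕ
        residue<p    : residue < p
        residue≢s    : residue ≢ s
        on-line      : R I line
        line-residue : M line % p ≡ s
        off-line     : ∀ ℓ → R I ℓ → ℓ ≢ line → M ℓ % p ≡ residue
    open Renitency public

    -- Under the local condition a point of A is flat or renitent; the
    -- exceptional residue t of the hypothesis is forced to be s.  Only the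
    -- fields of the result matter, so the search is kept abstract.
    abstract
      nonflat⇒renitency : ∀ {R} → LocalCondition Π p A R → R ∈ A → ¬ Flat R → Renitency R
      nonflat⇒renitency {R} (m , _ , m<p , _ , _ , at-most-one) R∈A ¬flat
        with any? (λ ℓ → T? (inc R ℓ) ×-dec ¬? (M ℓ % p ≟ℕ m))
      ... | no none = ⊥-elim (¬flat (λ ℓ Rℓ → forced-residue m R∈A Rℓ (λ ℓ′ Rℓ′ _ → to-m%p (all-m ℓ′ Rℓ′))))
        where
        all-m : ∀ ℓ → R I ℓ → M ℓ % p ≡ m
        all-m ℓ Rℓ = decidable-stable (M ℓ % p ≟ℕ m) (λ ≢m → none (ℓ , Rℓ , ≢m))
        to-m%p : ∀ {x} → x ≡ m → x ≡ m % p
        to-m%p x≡m = trans x≡m (sym (m<n⇒m%n≡m m<p))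
      ... | yes (ℓ₁ , Rℓ₁ , ℓ₁≢m) = record
        { line = ℓ₁ ; residue = m ; residue<p = m<p ; residue≢s = λ m≡s → ℓ₁≢m (trans ℓ₁≡s (sym m≡s))
        ; on-line = Rℓ₁ ; line-residue = ℓ₁≡s ; off-line = off }
        where
        not-m : ∀ {ℓ} → ¬ M ℓ % p ≡ m → ¬ M ℓ ≡ m [mod p ]
        not-m ≢m ≡m = ≢m (mod⇒residue m<p ≡m)
        off : ∀ ℓ → R I ℓ → ℓ ≢ ℓ₁ → M ℓ % p ≡ m
        off ℓ Rℓ ℓ≢ℓ₁ = decidable-stable (M ℓ % p ≟ℕ m)
          (λ ≢m → ℓ≢ℓ₁ (at-most-one ℓ ℓ₁ Rℓ Rℓ₁ (not-m ≢m) (not-m ℓ₁≢m)))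
        ℓ₁≡s : M ℓ₁ % p ≡ s
        ℓ₁≡s = forced-residue m R∈A Rℓ₁ (λ ℓ Rℓ ℓ≢ℓ₁ → trans (off ℓ Rℓ ℓ≢ℓ₁) (sym (m<n⇒m%n≡m m<p)))

    renitency⇒regular : ∀ {R} → Renitency R → Regular Π p A R
    renitency⇒regular r = line r , residue r , s , residue<p r , s<p , residue≢s r , on-line r ,
      residue⇒mod (line-residue r) , λ ℓ Rℓ ℓ≢line → residue⇒mod (off-line r ℓ Rℓ ℓ≢line)

    -- a flat point has no renitent line: a second line through it would carry both residues
    flat⇒irregular : ∀ {R} → Flat R → ¬ Regular Π p A R
    flat⇒irregular flat (ℓ , m , t , m<p , t<p , m≢t , Rℓ , ℓ≡t , others) with another-line Rℓ
    ... | ℓ′ , ℓ′≢ℓ , Rℓ′ = m≢t (begin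
      m          ≡⟨ mod⇒residue m<p (others ℓ′ Rℓ′ ℓ′≢ℓ) ⟨
      M ℓ′ % p   ≡⟨ flat ℓ′ Rℓ′ ⟩
      s          ≡⟨ flat ℓ Rℓ ⟨
      M ℓ % p    ≡⟨ mod⇒residue t<p ℓ≡t ⟩
      t          ∎)
      where open ≡-Reasoning

    renitent-unique : ∀ {R ℓ} → R ∈ A → (r : Renitency R) → Renitent Π p A R ℓ → ℓ ≡ line r
    renitent-unique {R} {ℓ} R∈A r (m′ , _ , _ , _ , _ , Rℓ , _ , others′) =
      decidable-stable (ℓ ≟ line r) (λ ℓ≢line → residue≢s r (trans (sym (off-line r ℓ Rℓ ℓ≢line)) ℓ≡s))
      where
      ℓ≡s : M ℓ % p ≡ s
      ℓ≡s = forced-residue m′ R∈A Rℓ (λ ℓ′ Rℓ′ ℓ′≢ℓ → mod⇒% (others′ ℓ′ Rℓ′ ℓ′≢ℓ))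

    residue-unique : ∀ {R} (r r′ : Renitency R) → residue r ≡ residue r′
    residue-unique r r′ with line r ≟ line r′
    ... | no  line≢ = ⊥-elim (residue≢s r′ (trans (sym (off-line r′ (line r) (on-line r) line≢)) (line-residue r)))
    ... | yes line≡ with another-line (on-line r)
    ... | ℓ , ℓ≢line , Rℓ =
      trans (sym (off-line r ℓ Rℓ ℓ≢line)) (off-line r′ ℓ Rℓ (λ ℓ≡ → ℓ≢line (trans ℓ≡ (sym line≡))))

    flat-on-renitent : ∀ {R Q} (r : Renitency R) → Flat Q → Q I line r
    flat-on-renitent {R} {Q} r flat-Q with R ≟ Q
    ... | yes refl = ⊥-elim (flat⇒irregular flat-Q (renitency⇒regular r))
    ... | no  R≢Q with two-points R Q R≢Q
    ... | L , RL , QL , _ with L ≟ line r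
    ... | yes L≡line = subst (Q I_) L≡line QL
    ... | no  L≢line = ⊥-elim (residue≢s r (trans (sym (off-line r L RL L≢line)) (flat-Q L QL)))

    residue-via-line : ∀ {R P L} (rR : Renitency R) (rP : Renitency P) → R I L → P I L → L ≢ line rR →
                       residue rR ≡ residue rP
    residue-via-line {L = L} rR rP RL PL L≢R with L ≟ line rP
    ... | yes refl = ⊥-elim (residue≢s rR (trans (sym (off-line rR L RL L≢R)) (line-residue rP)))
    ... | no  L≢P  = trans (sym (off-line rR L RL L≢R)) (off-line rP L PL L≢P)

    residue-via-point : ∀ {R X} (rR : Renitency R) (rX : Renitency X) → ¬ X I line rR →
                        residue rR ≡ residue rX
    residue-via-point {R} {X} rR rX ¬X-on with two-points R X (λ { refl → ¬X-on (on-line rR) })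
    ... | L , RL , XL , _ = residue-via-line rR rX RL XL (λ { refl → ¬X-on XL })

    lone-point : ∀ {L R ℓ} → (∀ X → X ∈ A → X I L) → R ∈ A → R I ℓ → ℓ ≢ L → M ℓ ≡ 1
    lone-point {L} {R} {ℓ} on-L R∈A Rℓ ℓ≢L =
      trans (meet-sum A ℓ) (trans (sum-single _ R off-R) (cong₂ _*_ (𝟙-T (∈⇒T R∈A)) (𝟙-T Rℓ)))
      where
      off-R : ∀ P → P ≢ R → 𝟙 (lookup A P) * 𝟙 (inc P ℓ) ≡ 0
      off-R P P≢R = 𝟙-disjoint _ _ (λ P∈A Pℓ →
        P≢R (meet-once ℓ≢L Pℓ (on-L P (T⇒∈ A P P∈A)) Rℓ (on-L R R∈A)))

    collinear-residue : ∀ {L R} → (∀ X → X ∈ A → X I L) → R ∈ A → R I L →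
                        ∀ ℓ → R I ℓ → ℓ ≢ L → M ℓ % p ≡ 1 % p
    collinear-residue on-L R∈A RL ℓ Rℓ ℓ≢L = cong (_% p) (lone-point on-L R∈A Rℓ ℓ≢L)

    collinear-renitency : ∀ {R} (r : Renitency R) → (∀ X → X ∈ A → X I line r) → R ∈ A →
                          residue r ≡ 1 % p
    collinear-renitency r on-line-r R∈A with another-line (on-line r)
    ... | ℓ , ℓ≢line , Rℓ =
      trans (sym (off-line r ℓ Rℓ ℓ≢line)) (collinear-residue on-line-r R∈A (on-line r) ℓ Rℓ ℓ≢line)

    collinear-flat : ∀ {L Q} → (∀ X → X ∈ A → X I L) → Q ∈ A → Q I L → Flat Q → 1 % p ≡ s
    collinear-flat on-L Q∈A QL flat-Q with another-line QL
    ... | ℓ , ℓ≢L , Qℓ = trans (sym (collinear-residue on-L Q∈A QL ℓ Qℓ ℓ≢L)) (flat-Q ℓ Qℓ)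

    -- If R and P share their renitent line
    -- L, compare both with a point off L, or, if there is none, use that A ⊆ L.
    residue-uniform : ∀ {R P} → R ∈ A → P ∈ A → (rR : Renitency R) (rP : Renitency P) →
      (∀ X → X ∈ A → ¬ X I line rR → Renitency X) → residue rR ≡ residue rP
    residue-uniform {R} {P} R∈A P∈A rR rP renitent-off with R ≟ P
    ... | yes refl = residue-unique rR rP
    ... | no  R≢P with two-points R P R≢P
    ... | L , RL , PL , _ with L ≟ line rR | L ≟ line rP
    ... | no  L≢R | _        = residue-via-line rR rP RL PL L≢R
    ... | yes _   | no  L≢P  = sym (residue-via-line rP rR PL RL L≢P)
    ... | yes refl | yes L≡P with any? (λ X → (X ∈? A) ×-dec ¬? (T? (inc X L)))
    ...   | yes (X , X∈A , ¬XL) =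
      let rX = renitent-off X X∈A ¬XL
      in trans (residue-via-point rR rX ¬XL) (sym (residue-via-point rP rX (subst (λ ℓ → ¬ X I ℓ) L≡P ¬XL)))
    ...   | no  none =
      let on-L : ∀ X → X ∈ A → X I L
          on-L X X∈A = decidable-stable (T? (inc X L)) (λ ¬XL → none (X , X∈A , ¬XL))
      in trans (collinear-renitency rR on-L R∈A)
               (sym (collinear-renitency rP (λ X X∈A → subst (X I_) L≡P (on-L X X∈A)) P∈A))

    -- Two distinct flat points of A exclude any renitent point: the renitent
    -- line of R₁ would contain all of A, giving both 1 ≡ s and 1 ≡ residue.
    flat-pair-excludes-renitency : (∀ X → X ∈ A → LocalCondition Π p A X) →
      ∀ {Q R R₁} → Q ∈ A → Flat Q → Flat R → Q ≢ R → R₁ ∈ A → Renitency R₁ → Empty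
    flat-pair-excludes-renitency local {Q} {R} Q∈A flat-Q flat-R Q≢R R₁∈A r₁ =
      residue≢s r₁ (trans (collinear-renitency r₁ on-L R₁∈A) (collinear-flat on-L Q∈A QL flat-Q))
      where
      L : Fin nLines
      L = line r₁
      QL : Q I L
      QL = flat-on-renitent r₁ flat-Q
      on-L : ∀ X → X ∈ A → X I L
      on-L X X∈A with flat? X
      ... | yes flat-X = flat-on-renitent r₁ flat-X
      ... | no ¬flat-X =
        let rX = nonflat⇒renitency (local X X∈A) X∈A ¬flat-X
        in subst (X I_) (join-once Q≢R (flat-on-renitent rX flat-Q) (flat-on-renitent rX flat-R)
                                      QL (flat-on-renitent r₁ flat-R)) (on-line rX)

    km-arc : A ⊂ ⊤ → ∀ {R₀} (R₀∈A : R₀ ∈ A) (renitency : ∀ R → R ∈ A → Renitency R) →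
             GenKMArc Π p (residue (renitency R₀ R₀∈A)) s A
    km-arc A⊂⊤ {R₀} R₀∈A renitency = residue<p r₀ , s<p , A⊂⊤ , (R₀ , R₀∈A) ,
      λ R R∈A → let rR = renitency R R∈A in
        line rR , on-line rR , residue⇒mod (line-residue rR) ,
        λ ℓ Rℓ ℓ≢line → residue⇒mod (trans (off-line rR ℓ Rℓ ℓ≢line)
          (residue-uniform R∈A R₀∈A rR r₀ (λ X X∈A _ → renitency X X∈A)))
      where
      r₀ : Renitency R₀
      r₀ = renitency R₀ R₀∈A

    all-renitent : A ⊂ ⊤ → Nonempty A → (∀ R → R ∈ A → Renitency R) → AllRegular A
    all-renitent A⊂⊤ (R₀ , R₀∈A) renitency =
      (λ R R∈A → renitency⇒regular (renitency R R∈A)) ,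
      residue (renitency R₀ R₀∈A) , s , residue≢s (renitency R₀ R₀∈A) , km-arc A⊂⊤ R₀∈A renitency

    all-flat : (∀ R → R ∈ A → Flat R) → AllIrregular A
    all-flat flat = (λ R R∈A → flat⇒irregular (flat R R∈A)) , s , s<p ,
      λ ℓ meets → let (P , P∈A , Pℓ) = point-on A ℓ meets in residue⇒mod (flat P P∈A ℓ Pℓ)

  module OneFlatPoint (A : Subset nPts) (A⊂⊤ : A ⊂ ⊤) (local : ∀ R → R ∈ A → LocalCondition Π p A R)
                      {Q R₁ : Fin nPts} (Q∈A : Q ∈ A) (R₁∈A : R₁ ∈ A)
                      where
    open Classification A
    module S = Classification (A ─ ⁅ Q ⁆)

    module _ (flat-Q : Flat Q) (¬flat-R₁ : ¬ Flat R₁) where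

      r₁ : Renitency R₁
      r₁ = nonflat⇒renitency (local R₁ R₁∈A) R₁∈A ¬flat-R₁

      renitency : ∀ {R} → R ∈ A → R ≢ Q → Renitency R
      renitency {R} R∈A R≢Q = nonflat⇒renitency (local R R∈A) R∈A
        (λ flat-R → flat-pair-excludes-renitency local Q∈A flat-Q flat-R (R≢Q ∘ sym) R₁∈A r₁)

      renitent-through-Q : ∀ R ℓ → R ∈ A → Renitent Π p A R ℓ → Q I ℓ
      renitent-through-Q R ℓ R∈A ren with R ≟ Q
      ... | yes refl = ⊥-elim (flat⇒irregular flat-Q (ℓ , ren))
      ... | no  R≢Q  = let rR = renitency R∈A R≢Q in
        subst (Q I_) (sym (renitent-unique R∈A rR ren)) (flat-on-renitent rR flat-Q)

      in-A : ∀ {R} → R ∈ A ─ ⁅ Q ⁆ → R ∈ A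
      in-A = p─q⊆p A ⁅ Q ⁆

      renitencyS : ∀ {R} → R ∈ A ─ ⁅ Q ⁆ → Renitency R
      renitencyS R∈S = renitency (in-A R∈S) (∈─⁅⁆⇒≢ R∈S)

      m : ℕ
      m = residue r₁

      residueS : ∀ {R} (R∈S : R ∈ A ─ ⁅ Q ⁆) → residue (renitencyS R∈S) ≡ m
      residueS R∈S = residue-uniform (in-A R∈S) R₁∈A (renitencyS R∈S) r₁
        (λ X X∈A ¬X-on → renitency X∈A (λ { refl → ¬X-on (flat-on-renitent (renitencyS R∈S) flat-Q) }))

      -- lines through R other than its renitent line miss Q, so removing Q keeps their residue m
      off-lineS : ∀ {R} (R∈S : R ∈ A ─ ⁅ Q ⁆) ℓ → R I ℓ → ℓ ≢ line (renitencyS R∈S) → S.M ℓ % p ≡ m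
      off-lineS R∈S ℓ Rℓ ℓ≢line =
        trans (cong (_% p) (meet-─⁅⁆ A ¬Qℓ)) (trans (off-line rR ℓ Rℓ ℓ≢line) (residueS R∈S))
        where
        rR : Renitency _
        rR = renitencyS R∈S
        ¬Qℓ : ¬ Q I ℓ
        ¬Qℓ Qℓ = ℓ≢line (join-once (∈─⁅⁆⇒≢ R∈S) Rℓ Qℓ (on-line rR) (flat-on-renitent rR flat-Q))

      line-residueS : ∀ {R} (R∈S : R ∈ A ─ ⁅ Q ⁆) → S.M (line (renitencyS R∈S)) % p ≡ S.s
      line-residueS R∈S = S.forced-residue m R∈S (on-line (renitencyS R∈S))
        (λ ℓ Rℓ ℓ≢line → trans (off-lineS R∈S ℓ Rℓ ℓ≢line) (sym (m<n⇒m%n≡m (residue<p r₁))))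

      -- the proper t-secants of A ─ ⁅ Q ⁆ are renitent lines, hence pass through Q
      t-secants-through-Q : m ≢ S.s → ∀ ℓ → S.M ℓ ≥ 1 → S.M ℓ ≡ S.s [mod p ] → Q I ℓ
      t-secants-through-Q m≢s ℓ meets ℓ≡s = decidable-stable (T? (inc Q ℓ)) λ ¬Qℓ →
        let (R , R∈S , Rℓ) = point-on (A ─ ⁅ Q ⁆) ℓ meets
            ℓ≢line : ℓ ≢ line (renitencyS R∈S)
            ℓ≢line ℓ≡line = ¬Qℓ (subst (Q I_) (sym ℓ≡line) (flat-on-renitent (renitencyS R∈S) flat-Q))
        in m≢s (trans (sym (off-lineS R∈S ℓ Rℓ ℓ≢line)) (mod⇒residue S.s<p ℓ≡s))

      A─Q⊂⊤ : A ─ ⁅ Q ⁆ ⊂ ⊤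
      A─Q⊂⊤ = let (_ , X , _ , X∉A) = A⊂⊤ in (λ _ → ∈⊤) , X , ∈⊤ , X∉A ∘ in-A

      R₁∈S : R₁ ∈ A ─ ⁅ Q ⁆
      R₁∈S = x∈p∧x≢y⇒x∈p-y R₁∈A (λ { refl → ¬flat-R₁ flat-Q })

      remainder : KMArcOrIntersecting (A ─ ⁅ Q ⁆)
      remainder with m ≟ℕ S.s
      ... | no m≢s = inj₁ (m , S.s , m≢s ,
            S.km-arc A─Q⊂⊤ R₁∈S renitencyS′ , Q , t-secants-through-Q m≢s)
        where
        renitencyS′ : ∀ R → R ∈ A ─ ⁅ Q ⁆ → S.Renitency R
        renitencyS′ R R∈S = record
          { line = line (renitencyS R∈S) ; residue = m ; residue<p = residue<p r₁ ; residue≢s = m≢s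
          ; on-line = on-line (renitencyS R∈S) ; line-residue = line-residueS R∈S ; off-line = off-lineS R∈S }
      ... | yes m≡s = inj₂ (proj₂ (S.all-flat flatS))
        where
        flatS : ∀ R → R ∈ A ─ ⁅ Q ⁆ → S.Flat R
        flatS R R∈S ℓ Rℓ with ℓ ≟ line (renitencyS R∈S)
        ... | yes ℓ≡line = subst (λ ℓ′ → S.M ℓ′ % p ≡ S.s) (sym ℓ≡line) (line-residueS R∈S)
        ... | no  ℓ≢line = trans (off-lineS R∈S ℓ Rℓ ℓ≢line) m≡s

      one-irregular : OneIrregular A
      one-irregular = Q , Q∈A , flat⇒irregular flat-Q ,
        (λ R R∈A R≢Q → renitency⇒regular (renitency R∈A R≢Q)) , renitent-through-Q , remainder

  module _ (A : Subset nPts) where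
    open Classification A

    classify : A ⊂ ⊤ → (∀ R → R ∈ A → LocalCondition Π p A R) → Nonempty A →
               AllRegular A ⊎ AllIrregular A ⊎ OneIrregular A
    classify A⊂⊤ local nonempty with any? (λ Q → (Q ∈? A) ×-dec flat? Q)
    ... | no no-flat = inj₁ (all-renitent A⊂⊤ nonempty
            (λ R R∈A → nonflat⇒renitency (local R R∈A) R∈A (λ flat-R → no-flat (R , R∈A , flat-R))))
    ... | yes (Q , Q∈A , flat-Q) with any? (λ R → (R ∈? A) ×-dec ¬? (flat? R))
    ...   | yes (R₁ , R₁∈A , ¬flat-R₁) =
            inj₂ (inj₂ (OneFlatPoint.one-irregular A A⊂⊤ local Q∈A R₁∈A flat-Q ¬flat-R₁))
    ...   | no  no-nonflat = inj₂ (inj₁ (all-flat (λ R R∈A →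
            decidable-stable (flat? R) (λ ¬flat-R → no-nonflat (R , R∈A , ¬flat-R)))))

divides-power : ∀ {p q} n → q ≡ p ^ n → 2 ≤ q → p ∣ q
divides-power zero    refl (s≤s ())
divides-power (suc n) refl _ = m∣m*n _

theorem4p2 : ∀ {q : ℕ} (Π : ProjectivePlane q) (p n : ℕ) → Prime p → q ≡ p ^ n →
    (A : Subset (ProjectivePlane.nPts Π)) → A ⊂ ⊤ →
    (∀ R → R ∈ A → LocalCondition Π p A R) →
    ((∀ R → R ∈ A → Regular Π p A R) ×
      (∃[ m ] ∃[ t ] (m ≢ t × GenKMArc Π p m t A)))
    ⊎
    ((∀ R → R ∈ A → ¬ Regular Π p A R) × (∃[ c ] Intersecting Π p c A))
    ⊎
    (∃[ Q ] (Q ∈ A × ¬ Regular Π p A Q ×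
      (∀ R → R ∈ A → R ≢ Q → Regular Π p A R) ×
      (∀ R ℓ → R ∈ A → Renitent Π p A R ℓ → _on_ Π Q ℓ) ×
      ((∃[ m ] ∃[ t ] (m ≢ t × GenKMArc Π p m t (A ─ ⁅ Q ⁆) ×
          (∃[ X ] (∀ ℓ → meet Π (A ─ ⁅ Q ⁆) ℓ ≥ 1 →
                   meet Π (A ─ ⁅ Q ⁆) ℓ ≡ t [mod p ] → _on_ Π X ℓ))))
       ⊎ (∃[ c ] Intersecting Π p c (A ─ ⁅ Q ⁆)))))
theorem4p2 {q} Π p n p-prime q≡pⁿ A A⊂⊤ local with nonempty? A
... | no  empty = inj₂ (inj₁ (Alternatives.empty-irregular Π p (>-nonZero⁻¹ p {{prime⇒nonZero p-prime}}) A empty))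
... | yes (R₀ , R₀∈A) = Setting.classify Π R₀≢X₀ p {{prime⇒nonZero p-prime}} p∣q A A⊂⊤ local (R₀ , R₀∈A)
  where
  -- a point outside A, distinct from R₀, makes the plane non-degenerate
  X₀ : Fin (ProjectivePlane.nPts Π)
  X₀ = proj₁ (proj₂ A⊂⊤)
  R₀≢X₀ : R₀ ≢ X₀
  R₀≢X₀ refl = proj₂ (proj₂ (proj₂ A⊂⊤)) R₀∈A
  p∣q : p ∣ q
  p∣q = divides-power n q≡pⁿ (Geometry.NonDegenerate.order≥2 Π R₀≢X₀)
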